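{- Let $W$ be a set and let $F:\mathscr P(W)\to\mathscr P(W)$ satisfy, for all $X,Y\subseteq W$: $F(X)\subseteq X$; if $X\neq\emptyset$ then $F(X)\neq\emptyset$; and $F(X\cap Y)=F(X)\cap Y$ whenever $F(X)\cap Y\neq\emptyset$. Define $\mathrm{ob}:\mathscr P(W)\to\mathscr P(\mathscr P(W))$ by $\mathrm{ob}(X)=\{Y\subseteq W: Y\cap X=F(X)\}$. Then $\mathrm{ob}$ satisfies: for all $X,Y,Z\subseteq W$, if $Y\subseteq X$, $Z\in\mathrm{ob}(X)$ and $Y\cap Z\neq\emptyset$, then $Z\in\mathrm{ob}(Y)$.
   Context: $F(X)$ is interpreted as the set of ideal worlds in context $X$. The conclusion is Carmo and Jones' condition 5(e). -}

module Defs where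

open import Level using (0ℓ)
open import Relation.Unary using (Pred; _⊆_; _∩_; _≐_; Satisfiable)

Subset : Set → Set₁
Subset W = Pred W 0ℓ

-- F respects extensional equality of subsets (automatic in set theory,
-- where sets with the same elements are equal).
Extensional : {W : Set} → (Subset W → Subset W) → Set₁
Extensional {W} F = ∀ (X Y : Subset W) → X ≐ Y → F X ≐ F Y

record SelectionFunction {W : Set} (F : Subset W → Subset W) : Set₁ where
  field
    ext       : Extensional F
    inclusion : ∀ (X : Subset W) → F X ⊆ X
    nonempty  : ∀ (X : Subset W) → Satisfiable X → Satisfiable (F X)
    cut       : ∀ (X Y : Subset W) → Satisfiable (F X ∩ Y) → F (X ∩ Y) ≐ (F X ∩ Y)

ob : {W : Set} → (Subset W → Subset W) → Subset W → Pred (Subset W) 0ℓ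
ob F X = λ Y → (Y ∩ X) ≐ F X

module Submission where

open import Defs
open import Relation.Unary using (Pred; _⊆_; _∩_; _∈_; _≐_; Satisfiable)
open import Relation.Unary.Properties using (≐-sym; ≐-trans)
open import Data.Product using (_,_; proj₁; proj₂; swap)
open import Level using (Level)

private
  variable
    a ℓ : Level
    A : Set a

∩-absorbˡ : {X Y : Pred A ℓ} → Y ⊆ X → (X ∩ Y) ≐ Y
∩-absorbˡ Y⊆X = proj₂ , λ y → Y⊆X y , y

∩-restrict : {X Y Z V : Pred A ℓ} → Y ⊆ X → (Z ∩ X) ≐ V → (Z ∩ Y) ≐ (V ∩ Y)
∩-restrict Y⊆X (ZX⊆V , V⊆ZX) =
  (λ (z , y) → ZX⊆V (z , Y⊆X y) , y) ,
  (λ (v , y) → proj₁ (V⊆ZX v) , y)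

Satisfiable-mono : {P Q : Pred A ℓ} → P ⊆ Q → Satisfiable P → Satisfiable Q
Satisfiable-mono P⊆Q (x , p) = x , P⊆Q p

theorem3 : (W : Set) (F : Subset W → Subset W) → SelectionFunction F →
    ∀ (X Y Z : Subset W) → Y ⊆ X → Z ∈ ob F X → Satisfiable (Y ∩ Z) → Z ∈ ob F Y
theorem3 W F sf X Y Z Y⊆X Z∈obX Y∩Z≠∅ =
  ≐-trans ZY≐FX∩Y (≐-trans (≐-sym F[X∩Y]≐FX∩Y) F[X∩Y]≐FY)
  where
  open SelectionFunction sf

  ZY≐FX∩Y : (Z ∩ Y) ≐ (F X ∩ Y)
  ZY≐FX∩Y = ∩-restrict Y⊆X Z∈obX

  F[X∩Y]≐FX∩Y : F (X ∩ Y) ≐ (F X ∩ Y)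
  F[X∩Y]≐FX∩Y = cut X Y (Satisfiable-mono (proj₁ ZY≐FX∩Y) (Satisfiable-mono swap Y∩Z≠∅))

  F[X∩Y]≐FY : F (X ∩ Y) ≐ F Y
  F[X∩Y]≐FY = ext (X ∩ Y) Y (∩-absorbˡ Y⊆X)
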